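{- Let $\beta,\gamma$ be beta-sets with $\beta\prec\gamma$, let $k$ be a positive integer, and let $A,B\subset\{1,2,\dots,k\}$ with $|A|\ge|B|$ and $|\gamma|\ge|(\beta+k)\cup A|$. Then $(\beta+k)\cup A\prec(\gamma+k)\cup B$.
   Context: A beta-set is a finite set of positive integers written decreasingly $\{\beta_1>\dots>\beta_n\}$, with associated partition $P(\beta)=(\beta_1-(n-1),\dots,\beta_n)$. For partitions $P=(P_1,\dots,P_n)$, $Q=(Q_1,\dots,Q_m)$ write $P<Q$ if $n\le m$ and $P_i\le Q_i$ for $i\le n$; $\beta\prec\gamma$ means $P(\beta)<P(\gamma)$. $\beta+k=\{x+k:x\in\beta\}$. -}

module Defs where

open import Data.Nat using (ℕ; _+_; _∸_; _≤_; _<_; _>_)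
open import Data.List using (List; []; _∷_; length; map)
open import Data.List.Relation.Unary.All using (All)
open import Data.List.Relation.Unary.Linked using (Linked)
open import Data.List.Membership.Propositional using (_∈_)
open import Data.Product using (_×_)
open import Data.Sum using (_⊎_)
open import Function.Bundles using (_⇔_)

-- A finite set of naturals, written decreasingly as a list (strictly decreasing).
DecList : List ℕ → Set
DecList xs = Linked _>_ xs

IsBetaSet : List ℕ → Set
IsBetaSet β = DecList β × All (λ x → 0 < x) β

partition : List ℕ → List ℕ
partition []       = []
partition (b ∷ bs) = (b ∸ length bs) ∷ partition bs

data _<ᴾ_ : List ℕ → List ℕ → Set where
  []<  : ∀ {qs} → [] <ᴾ qs
  ∷<   : ∀ {p q ps qs} → p ≤ q → ps <ᴾ qs → (p ∷ ps) <ᴾ (q ∷ qs)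

_≺_ : List ℕ → List ℕ → Set
β ≺ γ = partition β <ᴾ partition γ

_⊕_ : List ℕ → ℕ → List ℕ
β ⊕ k = map (_+ k) β

IsUnion : List ℕ → List ℕ → List ℕ → Set
IsUnion δ X Y = DecList δ × (∀ x → (x ∈ δ) ⇔ (x ∈ X ⊎ x ∈ Y))

SubsetUpTo : ℕ → List ℕ → Set
SubsetUpTo k A = DecList A × All (λ a → 1 ≤ a × a ≤ k) A

-- Since A ⊆ {1,…,k} lies entirely below β + k, the decreasing list of (β + k) ∪ A is
-- (β + k) followed by A, so its partition is P(β) shifted by k − |A|, followed by P(A);
-- likewise for (γ + k) ∪ B.  The first blocks compare entrywise because |B| ≤ |A|.  Every
-- part of P(A) is at most k + 1 − |A|, while every part of the γ-block is at least
-- k + 1 − |B|; the hypothesis |γ| ≥ |(β + k) ∪ A| makes the γ-block long enough to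
-- dominate all of P(A).
module Submission where

open import Defs
open import Data.Nat using (ℕ; suc; _+_; _∸_; _≤_; _<_; _>_; s≤s)
open import Data.Nat.Properties
open import Data.List using (List; []; _∷_; _++_; length; map)
open import Data.List.Properties using (length-map; length-++; map-∘)
open import Data.List.Relation.Unary.All as All using (All; []; _∷_)
import Data.List.Relation.Unary.All.Properties as All
open import Data.List.Relation.Unary.AllPairs as AllPairs using (AllPairs; []; _∷_)
import Data.List.Relation.Unary.AllPairs.Properties as AllPairs
open import Data.List.Relation.Unary.Linked.Properties using (Linked⇒AllPairs)
open import Data.List.Relation.Unary.Any using (here; there)
open import Data.List.Membership.Propositional using (_∈_)
open import Data.List.Membership.Propositional.Properties using (∈-++⁺ˡ; ∈-++⁺ʳ; ∈-++⁻)
open import Data.Product using (_,_; proj₂)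
open import Data.Sum using ([_,_])
open import Data.Empty using (⊥-elim)
open import Function using (_∘_)
open import Function.Bundles using (Equivalence)
open import Relation.Binary.PropositionalEquality
  using (_≡_; refl; sym; trans; cong; cong₂; subst; subst₂; module ≡-Reasoning)

Decreasing : List ℕ → Set
Decreasing = AllPairs _>_

DecList⇒Decreasing : ∀ {xs} → DecList xs → Decreasing xs
DecList⇒Decreasing = Linked⇒AllPairs (λ y<x z<y → <-trans z<y y<x)

head-maximal : ∀ {x xs z} → Decreasing (x ∷ xs) → z ∈ x ∷ xs → z ≤ x
head-maximal _          (here refl)  = ≤-refl
head-maximal (x>xs ∷ _) (there z∈xs) = <⇒≤ (All.lookup x>xs z∈xs)

∈-tail : ∀ {x xs z} → z < x → z ∈ x ∷ xs → z ∈ xs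
∈-tail z<x (here refl)  = ⊥-elim (<-irrefl refl z<x)
∈-tail _   (there z∈xs) = z∈xs

Decreasing-≡ : ∀ {xs ys} → Decreasing xs → Decreasing ys →
               (∀ {z} → z ∈ xs → z ∈ ys) → (∀ {z} → z ∈ ys → z ∈ xs) → xs ≡ ys
Decreasing-≡ [] []       _  _    = refl
Decreasing-≡ [] (_ ∷ _)  _  from with () ← from (here refl)
Decreasing-≡ (_ ∷ _) []  to _    with () ← to (here refl)
Decreasing-≡ xs↓@(x>xs ∷ xs'↓) ys↓@(y>ys ∷ ys'↓) to from
  with refl ← ≤-antisym (head-maximal ys↓ (to (here refl))) (head-maximal xs↓ (from (here refl)))
  = cong (_ ∷_) (Decreasing-≡ xs'↓ ys'↓
      (λ z∈xs → ∈-tail (All.lookup x>xs z∈xs) (to (there z∈xs)))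
      (λ z∈ys → ∈-tail (All.lookup y>ys z∈ys) (from (there z∈ys))))

IsUnion⇒≡++ : ∀ {δ X Y} → IsUnion δ X Y → Decreasing X → Decreasing Y →
              All (λ x → All (x >_) Y) X → δ ≡ X ++ Y
IsUnion⇒≡++ {X = X} (δ↓ , δ≡X∪Y) X↓ Y↓ X>Y =
  Decreasing-≡ (DecList⇒Decreasing δ↓) (AllPairs.++⁺ X↓ Y↓ X>Y)
    (λ {z} → [ ∈-++⁺ˡ , ∈-++⁺ʳ X ] ∘ Equivalence.to (δ≡X∪Y z))
    (λ {z} → Equivalence.from (δ≡X∪Y z) ∘ ∈-++⁻ X)

⊕-decreasing : ∀ {xs} k → Decreasing xs → Decreasing (xs ⊕ k)
⊕-decreasing k = AllPairs.map⁺ ∘ AllPairs.map (+-monoˡ-< k)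

⊕-above : ∀ {xs} k → All (0 <_) xs → All (k <_) (xs ⊕ k)
⊕-above k = All.map⁺ ∘ All.map (λ {x} 0<x → subst (k <_) (+-comm k x) (m<m+n k 0<x))

length-partition : ∀ xs → length (partition xs) ≡ length xs
length-partition []       = refl
length-partition (x ∷ xs) = cong suc (length-partition xs)

partition-++ : ∀ xs ys → partition (xs ++ ys) ≡ map (_∸ length ys) (partition xs) ++ partition ys
partition-++ []       ys = refl
partition-++ (x ∷ xs) ys = cong₂ _∷_
  (trans (cong (x ∸_) (length-++ xs)) (sym (∸-+-assoc x (length xs) (length ys))))
  (partition-++ xs ys)

length-tail<head : ∀ {x xs} → Decreasing (x ∷ xs) → All (0 <_) (x ∷ xs) → length xs < x
length-tail<head {xs = []}    _                 (0<x ∷ _)  = 0<x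
length-tail<head {xs = y ∷ _} ((y<x ∷ _) ∷ xs↓) (_ ∷ xs>0) =
  <-≤-trans (s≤s (length-tail<head xs↓ xs>0)) y<x

partition-⊕ : ∀ {xs} k → Decreasing xs → All (0 <_) xs → partition (xs ⊕ k) ≡ map (_+ k) (partition xs)
partition-⊕ {[]}     k _                _                  = refl
partition-⊕ {x ∷ xs} k xs↓@(_ ∷ xs'↓) xs>0@(_ ∷ xs'>0) = cong₂ _∷_
  (trans (cong (x + k ∸_) (length-map (_+ k) xs)) (+-∸-comm k (<⇒≤ (length-tail<head xs↓ xs>0))))
  (partition-⊕ k xs'↓ xs'>0)

partition-positive : ∀ {xs} → Decreasing xs → All (0 <_) xs → All (0 <_) (partition xs)
partition-positive {[]}    _                _                  = []
partition-positive {_ ∷ _} xs↓@(_ ∷ xs'↓) xs>0@(_ ∷ xs'>0) =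
  m<n⇒0<n∸m (length-tail<head xs↓ xs>0) ∷ partition-positive xs'↓ xs'>0

∸-suc-mono : ∀ {x v} n → x < v → x ∸ n ≤ v ∸ suc n
∸-suc-mono {v = v} n x<v = ≤-trans (∸-monoˡ-≤ n (<⇒≤pred x<v)) (≤-reflexive (∸-+-assoc v 1 n))

partition-bounded : ∀ {xs v} → Decreasing xs → All (_< v) xs → All (_≤ v ∸ length xs) (partition xs)
partition-bounded []               []        = []
partition-bounded {x ∷ xs} (x>xs ∷ xs↓) (x<v ∷ _) =
  ∸-suc-mono (length xs) x<v ∷ All.map (λ r≤ → ≤-trans r≤ (∸-suc-mono (length xs) x<v))
                                       (partition-bounded xs↓ x>xs)

shift : ℕ → ℕ → List ℕ → List ℕ
shift k a = map (λ p → p + k ∸ a)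

<ᴾ-shift : ∀ {P Q a b} k → b ≤ a → P <ᴾ Q → shift k a P <ᴾ shift k b Q
<ᴾ-shift k b≤a []<          = []<
<ᴾ-shift k b≤a (∷< p≤q P<Q) = ∷< (∸-mono (+-monoˡ-≤ k p≤q) b≤a) (<ᴾ-shift k b≤a P<Q)

<ᴾ-below-above : ∀ {t rs qs} ts → All (_≤ t) rs → All (t ≤_) qs → length rs ≤ length qs → rs <ᴾ (qs ++ ts)
<ᴾ-below-above {rs = []}            ts _            _            _         = []<
<ᴾ-below-above {rs = _ ∷ _} {_ ∷ _} ts (r≤t ∷ rs≤t) (t≤q ∷ qs≥t) (s≤s len) =
  ∷< (≤-trans r≤t t≤q) (<ᴾ-below-above ts rs≤t qs≥t len)

<ᴾ-++ : ∀ {t ps qs rs} ts → ps <ᴾ qs → All (_≤ t) rs → All (t ≤_) qs →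
        length (ps ++ rs) ≤ length qs → (ps ++ rs) <ᴾ (qs ++ ts)
<ᴾ-++ ts []<          rs≤t qs≥t       len       = <ᴾ-below-above ts rs≤t qs≥t len
<ᴾ-++ ts (∷< p≤q P<Q) rs≤t (_ ∷ qs≥t) (s≤s len) = ∷< p≤q (<ᴾ-++ ts P<Q rs≤t qs≥t len)

partition-⊕-∪ : ∀ {β A δ} k → IsBetaSet β → SubsetUpTo k A → IsUnion δ (β ⊕ k) A →
                partition δ ≡ shift k (length A) (partition β) ++ partition A
partition-⊕-∪ {β} {A} {δ} k (β↓ , β>0) (A↓ , A⊆k) δ≡β⊕k∪A = begin
  partition δ                                                  ≡⟨ cong partition δ≡β⊕k++A ⟩
  partition (β ⊕ k ++ A)                                       ≡⟨ partition-++ (β ⊕ k) A ⟩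
  map (_∸ length A) (partition (β ⊕ k)) ++ partition A         ≡⟨ cong (λ P → map (_∸ length A) P ++ partition A)
                                                                       (partition-⊕ k β↓' β>0) ⟩
  map (_∸ length A) (map (_+ k) (partition β)) ++ partition A  ≡⟨ cong (_++ partition A) (map-∘ (partition β)) ⟨
  shift k (length A) (partition β) ++ partition A              ∎
  where
  open ≡-Reasoning
  β↓' = DecList⇒Decreasing β↓
  β⊕k>A : All (λ x → All (x >_) A) (β ⊕ k)
  β⊕k>A = All.map (λ k<x → All.map (λ (_ , a≤k) → ≤-<-trans a≤k k<x) A⊆k) (⊕-above k β>0)
  δ≡β⊕k++A = IsUnion⇒≡++ δ≡β⊕k∪A (⊕-decreasing k β↓') (DecList⇒Decreasing A↓) β⊕k>A

lemma5p1 : (β γ : List ℕ) → IsBetaSet β → IsBetaSet γ → β ≺ γ →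
           (k : ℕ) → 1 ≤ k →
           (A B : List ℕ) → SubsetUpTo k A → SubsetUpTo k B →
           length B ≤ length A →
           (δ ε : List ℕ) → IsUnion δ (β ⊕ k) A → IsUnion ε (γ ⊕ k) B →
           length δ ≤ length γ →
           δ ≺ ε
lemma5p1 β γ βset γset@(γ↓ , γ>0) β≺γ k _ A B Aset@(A↓ , A⊆k) Bset |B|≤|A| δ ε δ∪ ε∪ |δ|≤|γ| =
  subst₂ _<ᴾ_ (sym Pδ) (sym Pε) (<ᴾ-++ (partition B) (<ᴾ-shift k |B|≤|A| β≺γ) PA-small Pγ-large lengths)
  where
  Pδ = partition-⊕-∪ k βset Aset δ∪
  Pε = partition-⊕-∪ k γset Bset ε∪
  PA-small : All (_≤ suc k ∸ length A) (partition A)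
  PA-small = partition-bounded (DecList⇒Decreasing A↓) (All.map (s≤s ∘ proj₂) A⊆k)
  Pγ-large : All (suc k ∸ length A ≤_) (shift k (length B) (partition γ))
  Pγ-large = All.map⁺ (All.map (λ 0<q → ∸-mono (+-monoˡ-≤ k 0<q) |B|≤|A|)
                                (partition-positive (DecList⇒Decreasing γ↓) γ>0))
  lengths : length (shift k (length A) (partition β) ++ partition A)
            ≤ length (shift k (length B) (partition γ))
  lengths = begin
    length (shift k (length A) (partition β) ++ partition A)  ≡⟨ cong length Pδ ⟨
    length (partition δ)                                      ≡⟨ length-partition δ ⟩
    length δ                                                  ≤⟨ |δ|≤|γ| ⟩
    length γ                                                  ≡⟨ length-partition γ ⟨
    length (partition γ)                                      ≡⟨ length-map _ (partition γ) ⟨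
    length (shift k (length B) (partition γ))                 ∎
    where open ≤-Reasoning
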